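{- Let $G$ be an $n\times n$ grid graph with $n>1$, and let $c$ be a center vertex of $G$. Let $V'$ be a set of vertices of $G$ such that every vertex of $V'$ has the same distance from $c$. Then $|V'|\le 2n-2$.
   Context: An $n\times n$ grid graph has as vertices the points of an $n\times n$ integer grid and edges between grid points at unit distance; distances are shortest-path lengths. The eccentricity of a vertex $u$ is $\max_{v} d(u,v)$; a center vertex is a vertex of minimum eccentricity. -}

module Defs where

open import Data.Nat using (ℕ; zero; suc; _≤_)
open import Data.Fin using (Fin; toℕ)
open import Data.Product using (_×_; _,_; ∃-syntax)
open import Data.Sum using (_⊎_)
open import Relation.Binary.PropositionalEquality using (_≡_)

Vertex : ℕ → Set
Vertex n = Fin n × Fin n

Step : ℕ → ℕ → Set
Step a b = suc a ≡ b ⊎ suc b ≡ a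

Adj : ∀ {n} → Vertex n → Vertex n → Set
Adj (i , j) (i' , j') =
  (i ≡ i' × Step (toℕ j) (toℕ j')) ⊎ (j ≡ j' × Step (toℕ i) (toℕ i'))

data Walk {n : ℕ} : Vertex n → Vertex n → ℕ → Set where
  here : ∀ {u} → Walk u u 0
  step : ∀ {u v w k} → Adj u v → Walk v w k → Walk u w (suc k)

Dist : ∀ {n} → Vertex n → Vertex n → ℕ → Set
Dist u v k = Walk u v k × (∀ m → Walk u v m → k ≤ m)

Ecc : ∀ {n} → Vertex n → ℕ → Set
Ecc {n} u e =
  (∀ (v : Vertex n) k → Dist u v k → k ≤ e) × (∃[ v ] Dist u v e)

Center : ∀ {n} → Vertex n → Set
Center {n} c =
  ∃[ e ] (Ecc c e × (∀ (u : Vertex n) e' → Ecc u e' → e ≤ e'))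

-- Write k = n − 1. Grid distance is Manhattan distance, so comparing the
-- distances from a center c = (a , b) to the four corners with the
-- eccentricity 2⌈k/2⌉ of the midpoint shows a, b ∈ {⌊k/2⌋, ⌈k/2⌉}.
-- Send a vertex (i , j) of the sphere of radius r ≥ 1 about c to the slot
-- 2i + [b < j]: a column meets the sphere in at most one vertex on each side
-- of row b, so this is injective into 2n slots, and it suffices to find two
-- empty slots. If 2r ≤ k, the columns a ± r exist and meet the sphere only
-- in row b. If 2r > k, column a meets the sphere at most once; a second empty
-- slot comes from a column a ± r, or else from a neighbouring column of a
-- when 2(r − 1) > k, or else column a misses the sphere altogether.

module Submission where

open import Defs
open import Data.Bool using (Bool; true; false)
open import Data.Fin using (Fin; toℕ; fromℕ<) renaming (zero to fzero)
open import Data.Fin.Properties using (toℕ-injective; toℕ-fromℕ<; toℕ<n)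
open import Data.List using (List; []; _∷_; length; map; filter)
open import Data.List.Properties using (filter-all; filter-accept; filter-reject; length-map)
open import Data.List.Relation.Unary.All as All using (All; []; _∷_)
open import Data.List.Relation.Unary.All.Properties using (all-filter; map⁺)
open import Data.List.Relation.Unary.AllPairs using ([]; _∷_)
open import Data.List.Relation.Unary.Unique.Propositional using (Unique)
import Data.List.Relation.Unary.Unique.Propositional.Properties as Unique
open import Data.Nat using (ℕ; zero; suc; _+_; _*_; _∸_; _%_; _≤_; _<_; z≤n; s≤s; z<s; ∣_-_∣; ⌈_/2⌉; _<ᵇ_; _<?_; _≤?_)
open import Data.Nat.DivMod using ([m+kn]%n≡m%n; m*n%n≡0)
open import Data.Nat.Properties
open import Algebra.Properties.CommutativeSemigroup +-commutativeSemigroup using (interchange)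
open import Data.Product using (Σ; ∃₂; _×_; _,_; proj₁; proj₂)
open import Data.Product.Properties using (,-injective; ,-injectiveʳ)
open import Data.Sum using (_⊎_; inj₁; inj₂)
open import Function using (_∘_)
open import Relation.Binary.PropositionalEquality
open import Relation.Nullary using (yes; no; contradiction)
open import Relation.Nullary.Reflects using (ofʸ; ofⁿ)

variable
  n k l : ℕ

m≤n⇒m+∣m-n∣≡n : ∀ {m n} → m ≤ n → m + ∣ m - n ∣ ≡ n
m≤n⇒m+∣m-n∣≡n m≤n = trans (cong (_ +_) (m≤n⇒∣m-n∣≡n∸m m≤n)) (m+[n∸m]≡n m≤n)

m≤n⇒m+∣n-m∣≡n : ∀ {m n} → m ≤ n → m + ∣ n - m ∣ ≡ n
m≤n⇒m+∣n-m∣≡n m≤n = trans (cong (_ +_) (m≤n⇒∣n-m∣≡n∸m m≤n)) (m+[n∸m]≡n m≤n)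

∣m-[m∸n]∣≡n : ∀ {m n} → n ≤ m → ∣ m - (m ∸ n) ∣ ≡ n
∣m-[m∸n]∣≡n {m} {n} n≤m = trans (m≤n⇒∣n-m∣≡n∸m (m∸n≤m m n)) (m∸[m∸n]≡n n≤m)

∣m-n∣≡1+o⇒m≢n : ∀ {m n o} → ∣ m - n ∣ ≡ suc o → m ≢ n
∣m-n∣≡1+o⇒m≢n {m} e refl = 0≢1+n (trans (sym (∣n-n∣≡0 m)) e)

Step⇒∣-∣≡1 : ∀ {x y} → Step x y → ∣ x - y ∣ ≡ 1
Step⇒∣-∣≡1 {x} (inj₁ refl) = subst (λ y → ∣ x - y ∣ ≡ 1) (+-comm x 1) (∣m-m+n∣≡n x 1)
Step⇒∣-∣≡1 {y = y} (inj₂ refl) = trans (∣-∣-comm (suc y) y) (Step⇒∣-∣≡1 {y} (inj₁ refl))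

∣-∣-step : ∀ {x y} z → Step x y → ∣ x - z ∣ ≤ suc ∣ y - z ∣
∣-∣-step {x} {y} z s = begin
  ∣ x - z ∣               ≤⟨ ∣-∣-triangle x y z ⟩
  ∣ x - y ∣ + ∣ y - z ∣   ≡⟨ cong (_+ ∣ y - z ∣) (Step⇒∣-∣≡1 s) ⟩
  suc ∣ y - z ∣           ∎
  where open ≤-Reasoning

halve-≤ : ∀ {x y} → x + x ≤ suc (y + y) → x ≤ y
halve-≤ {x} {y} x+x≤1+y+y = ≮⇒≥ λ y<x → 1+n≰n (begin
  suc (suc (y + y))  ≡⟨ cong suc (+-suc y y) ⟨
  suc y + suc y      ≤⟨ +-mono-≤ y<x y<x ⟩
  x + x              ≤⟨ x+x≤1+y+y ⟩
  suc (y + y)        ∎)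
  where open ≤-Reasoning

∣m-n∣≤m : ∀ m n → n ≤ m + m → ∣ m - n ∣ ≤ m
∣m-n∣≤m m n n≤m+m with ≤-total m n
... | inj₁ m≤n = begin
  ∣ m - n ∣    ≡⟨ m≤n⇒∣m-n∣≡n∸m m≤n ⟩
  n ∸ m        ≤⟨ ∸-monoˡ-≤ m n≤m+m ⟩
  m + m ∸ m    ≡⟨ m+n∸m≡n m m ⟩
  m            ∎
  where open ≤-Reasoning
... | inj₂ n≤m = ≤-trans (≤-reflexive (m≤n⇒∣n-m∣≡n∸m n≤m)) (m∸n≤m m n)

opposite-sides : ∀ {x y y' m k} → x + y ≤ m + m → x + y' ≤ m + m → y + y' ≡ k → m + m ≤ suc k →
                 x + x ≤ suc k
opposite-sides {x} {y} {y'} {m} {k} x+y≤ x+y'≤ y+y'≡k m+m≤1+k = ≤-trans (+-mono-≤ x≤m x≤m) m+m≤1+k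
  where
  open ≤-Reasoning
  x≤m : x ≤ m
  x≤m = halve-≤ (+-cancelʳ-≤ k (x + x) (suc (m + m)) (begin
    (x + x) + k          ≡⟨ cong ((x + x) +_) y+y'≡k ⟨
    (x + x) + (y + y')   ≡⟨ interchange x x y y' ⟩
    (x + y) + (x + y')   ≤⟨ +-mono-≤ x+y≤ x+y'≤ ⟩
    (m + m) + (m + m)    ≤⟨ +-monoʳ-≤ (m + m) m+m≤1+k ⟩
    (m + m) + suc k      ≡⟨ +-suc (m + m) k ⟩
    suc (m + m) + k      ∎))

neighbour : ∀ {a k} → 0 < k → a ≤ k → Σ ℕ λ q → q ≤ k × ∣ a - q ∣ ≡ 1
neighbour {zero}  {suc k} _ _         = 1 , s≤s z≤n , refl
neighbour {suc a} {suc k} _ (s≤s a≤k) = a , m≤n⇒m≤1+n a≤k , Step⇒∣-∣≡1 {suc a} (inj₂ refl)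

length≤1+filter< : ∀ N {xs} → Unique xs → All (_< suc N) xs → length xs ≤ suc (length (filter (_<? N) xs))
length≤1+filter< N {[]}     _             _                = z≤n
length≤1+filter< N {x ∷ xs} (x∉xs ∷ !xs) (x<1+N ∷ xs<1+N) with x <? N
... | yes x<N = begin
  suc (length xs)                               ≤⟨ s≤s (length≤1+filter< N !xs xs<1+N) ⟩
  suc (length (x ∷ filter (_<? N) xs))          ≡⟨ cong (suc ∘ length) (filter-accept (_<? N) x<N) ⟨
  suc (length (filter (_<? N) (x ∷ xs)))        ∎
  where open ≤-Reasoning
... | no x≮N = begin
  suc (length xs)                               ≡⟨ cong (suc ∘ length) (filter-all (_<? N) xs<N) ⟨
  suc (length (filter (_<? N) xs))              ≡⟨ cong (suc ∘ length) (filter-reject (_<? N) x≮N) ⟨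
  suc (length (filter (_<? N) (x ∷ xs)))        ∎
  where
  open ≤-Reasoning
  xs<N : All (_< N) xs
  xs<N = All.zipWith (λ (x≢y , y<1+N) → ≤∧≢⇒< (≤-pred y<1+N) λ y≡N →
                       x≢y (trans (≤∧≮⇒≡ (≤-pred x<1+N) x≮N) (sym y≡N)))
                     (x∉xs , xs<1+N)

unique-bounded-length : ∀ N {xs} → Unique xs → All (_< N) xs → length xs ≤ N
unique-bounded-length zero    {[]}    _   _        = z≤n
unique-bounded-length zero    {_ ∷ _} _   (() ∷ _)
unique-bounded-length (suc N) {xs}    !xs xs<1+N =
  ≤-trans (length≤1+filter< N !xs xs<1+N)
          (s≤s (unique-bounded-length N (Unique.filter⁺ (_<? N) !xs) (all-filter (_<? N) xs)))

length≤1-of-constant : ∀ {A : Set} {c : A} {xs} → Unique xs → All (_≡ c) xs → length xs ≤ 1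
length≤1-of-constant {xs = []}     _ _ = z≤n
length≤1-of-constant {xs = _ ∷ []} _ _ = s≤s z≤n
length≤1-of-constant ((x≢y ∷ _) ∷ _) (x≡c ∷ y≡c ∷ _) = contradiction (trans x≡c (sym y≡c)) x≢y

map⁺-on : ∀ {A B : Set} {P : A → Set} (f : A → B) → (∀ {x y} → P x → P y → f x ≡ f y → x ≡ y) →
          ∀ {xs} → All P xs → Unique xs → Unique (map f xs)
map⁺-on f inj []          []            = []
map⁺-on f inj (px ∷ pxs) (x∉xs ∷ !xs) =
  map⁺ (All.zipWith (λ (py , x≢y) fx≡fy → x≢y (inj px py fx≡fy)) (pxs , x∉xs)) ∷ map⁺-on f inj pxs !xs

infixr 5 _++ᵂ_

_++ᵂ_ : {u v w : Vertex n} → Walk u v k → Walk v w l → Walk u w (k + l)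
here     ++ᵂ q = q
step a p ++ᵂ q = step a (p ++ᵂ q)

manhattan : Vertex n → Vertex n → ℕ
manhattan (i , j) (i' , j') = ∣ toℕ i - toℕ i' ∣ + ∣ toℕ j - toℕ j' ∣

module Line (f : Fin n → Vertex n)
            (adj : ∀ x y → Step (toℕ x) (toℕ y) → Adj (f x) (f y)) where

  ascending : ∀ d (x y : Fin n) → toℕ x + d ≡ toℕ y → Walk (f x) (f y) d
  ascending zero x y x+0≡y with refl ← toℕ-injective (trans (sym (+-identityʳ _)) x+0≡y) = here
  ascending (suc d) x y x+1+d≡y = step (adj x x' (inj₁ (sym (toℕ-fromℕ< x'<n)))) (ascending d x' y x'+d≡y)
    where
    1+x+d≡y : suc (toℕ x + d) ≡ toℕ y
    1+x+d≡y = trans (sym (+-suc _ d)) x+1+d≡y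
    x'<n : suc (toℕ x) < n
    x'<n = ≤-<-trans (≤-trans (m≤m+n _ d) (≤-reflexive 1+x+d≡y)) (toℕ<n y)
    x' = fromℕ< x'<n
    x'+d≡y : toℕ x' + d ≡ toℕ y
    x'+d≡y = trans (cong (_+ d) (toℕ-fromℕ< x'<n)) 1+x+d≡y

  descending : ∀ d (x y : Fin n) → toℕ y + d ≡ toℕ x → Walk (f x) (f y) d
  descending zero x y y+0≡x with refl ← toℕ-injective (trans (sym (+-identityʳ _)) y+0≡x) = here
  descending (suc d) x y y+1+d≡x = step (adj x x' (inj₂ 1+x'≡x)) (descending d x' y (sym (toℕ-fromℕ< x'<n)))
    where
    1+y+d≡x : suc (toℕ y + d) ≡ toℕ x
    1+y+d≡x = trans (sym (+-suc _ d)) y+1+d≡x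
    x'<n : toℕ y + d < n
    x'<n = <-≤-trans (≤-reflexive 1+y+d≡x) (<⇒≤ (toℕ<n x))
    x' = fromℕ< x'<n
    1+x'≡x : suc (toℕ x') ≡ toℕ x
    1+x'≡x = trans (cong suc (toℕ-fromℕ< x'<n)) 1+y+d≡x

  straight : ∀ x y → Walk (f x) (f y) ∣ toℕ x - toℕ y ∣
  straight x y with ≤-total (toℕ x) (toℕ y)
  ... | inj₁ x≤y = ascending _ x y (m≤n⇒m+∣m-n∣≡n x≤y)
  ... | inj₂ y≤x = descending _ x y (m≤n⇒m+∣n-m∣≡n y≤x)

manhattan-walk : (u v : Vertex n) → Walk u v (manhattan u v)
manhattan-walk (i , j) (i' , j') = Row.straight i i' ++ᵂ Column.straight j j'
  where
  module Row    = Line (_, j)  (λ _ _ s → inj₂ (refl , s))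
  module Column = Line (i' ,_) (λ _ _ s → inj₁ (refl , s))

manhattan-adj : {u w : Vertex n} (v : Vertex n) → Adj u w → manhattan u v ≤ suc (manhattan w v)
manhattan-adj {u = i , _} (i' , j') (inj₁ (refl , s)) =
  ≤-trans (+-monoʳ-≤ ∣ toℕ i - toℕ i' ∣ (∣-∣-step (toℕ j') s)) (≤-reflexive (+-suc _ _))
manhattan-adj {u = _ , j} (i' , j') (inj₂ (refl , s)) =
  +-monoˡ-≤ ∣ toℕ j - toℕ j' ∣ (∣-∣-step (toℕ i') s)

manhattan≤length : {u v : Vertex n} → Walk u v k → manhattan u v ≤ k
manhattan≤length {u = i , j} here =
  ≤-reflexive (cong₂ _+_ (∣n-n∣≡0 (toℕ i)) (∣n-n∣≡0 (toℕ j)))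
manhattan≤length {v = v} (step a p) = ≤-trans (manhattan-adj v a) (s≤s (manhattan≤length p))

Dist-manhattan : (u v : Vertex n) → Dist u v (manhattan u v)
Dist-manhattan u v = manhattan-walk u v , λ _ → manhattan≤length

Dist⇒≡manhattan : {u v : Vertex n} → Dist u v k → k ≡ manhattan u v
Dist⇒≡manhattan {u = u} {v} (p , minimal) = ≤-antisym (minimal _ (manhattan-walk u v)) (manhattan≤length p)

Dist-zero⇒≡ : {u v : Vertex n} → Dist u v 0 → v ≡ u
Dist-zero⇒≡ (here , _) = refl

-- a ∈ {⌊k/2⌋, ⌈k/2⌉}
Central : ℕ → ℕ → Set
Central k a = a + a ≤ suc k × k ≤ suc (a + a)

central : ∀ {k a} → a ≤ k → ∣ a - 0 ∣ + ∣ a - 0 ∣ ≤ suc k → ∣ a - k ∣ + ∣ a - k ∣ ≤ suc k → Central k a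
central {k} {a} a≤k 2a≤1+k 2d≤1+k = subst (λ x → x + x ≤ suc k) (∣-∣-identityʳ a) 2a≤1+k , (begin
  k              ≡⟨ m≤n⇒m+∣m-n∣≡n a≤k ⟨
  a + ∣ a - k ∣  ≤⟨ +-monoʳ-≤ a d≤1+a ⟩
  a + suc a      ≡⟨ +-suc a a ⟩
  suc (a + a)    ∎)
  where
  open ≤-Reasoning
  d≤1+a : ∣ a - k ∣ ≤ suc a
  d≤1+a = +-cancelʳ-≤ ∣ a - k ∣ _ _ (≤-trans 2d≤1+k (≤-reflexive (cong suc (sym (m≤n⇒m+∣m-n∣≡n a≤k)))))

module Midpoint (k : ℕ) where

  M : ℕ
  M = ⌈ k /2⌉

  k≤M+M : k ≤ M + M
  k≤M+M = ≤-trans (≤-reflexive (sym (⌊n/2⌋+⌈n/2⌉≡n k))) (+-monoˡ-≤ M (⌊n/2⌋≤⌈n/2⌉ k))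

  M+M≤1+k : M + M ≤ suc k
  M+M≤1+k = ≤-trans (+-monoˡ-≤ M (⌊n/2⌋-mono (n≤1+n (suc k)))) (≤-reflexive (cong suc (⌊n/2⌋+⌈n/2⌉≡n k)))

  M<1+k : M < suc k
  M<1+k = s≤s (⌈n/2⌉≤n k)

  mid : Vertex (suc k)
  mid = fromℕ< M<1+k , fromℕ< M<1+k

  mid-coordinate : (x : Fin (suc k)) → ∣ toℕ (fromℕ< M<1+k) - toℕ x ∣ ≤ M
  mid-coordinate x rewrite toℕ-fromℕ< M<1+k = ∣m-n∣≤m M (toℕ x) (≤-trans (≤-pred (toℕ<n x)) k≤M+M)

  Ecc-mid : Ecc mid (M + M)
  Ecc-mid = bounded , (fzero , fzero) , subst (Dist mid (fzero , fzero)) to-corner (Dist-manhattan mid _)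
    where
    bounded : ∀ v d → Dist mid v d → d ≤ M + M
    bounded (i , j) d dist =
      ≤-trans (≤-reflexive (Dist⇒≡manhattan dist)) (+-mono-≤ (mid-coordinate i) (mid-coordinate j))
    to-corner : manhattan mid (fzero , fzero) ≡ M + M
    to-corner = cong₂ _+_ M-0≡M M-0≡M
      where
      M-0≡M : ∣ toℕ (fromℕ< M<1+k) - 0 ∣ ≡ M
      M-0≡M = trans (∣-∣-identityʳ _) (toℕ-fromℕ< M<1+k)

  center⇒manhattan≤ : {c : Vertex (suc k)} → Center c → ∀ w → manhattan c w ≤ M + M
  center⇒manhattan≤ {c} (_ , (ecc-bound , _) , minimal) w =
    ≤-trans (ecc-bound w _ (Dist-manhattan c w)) (minimal mid (M + M) Ecc-mid)

  center⇒central : ∀ {i j} → Center (i , j) → Central k (toℕ i) × Central k (toℕ j)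
  center⇒central {i} {j} center = coordinate a≤k b≤k point , coordinate b≤k a≤k point′
    where
    a = toℕ i
    b = toℕ j
    a≤k = ≤-pred (toℕ<n i)
    b≤k = ≤-pred (toℕ<n j)
    point : ∀ {x y} → x ≤ k → y ≤ k → ∣ a - x ∣ + ∣ b - y ∣ ≤ M + M
    point x≤k y≤k =
      subst₂ (λ x y → ∣ a - x ∣ + ∣ b - y ∣ ≤ M + M) (toℕ-fromℕ< (s≤s x≤k)) (toℕ-fromℕ< (s≤s y≤k))
             (center⇒manhattan≤ center (fromℕ< (s≤s x≤k) , fromℕ< (s≤s y≤k)))
    point′ : ∀ {y x} → y ≤ k → x ≤ k → ∣ b - y ∣ + ∣ a - x ∣ ≤ M + M
    point′ {y} {x} y≤k x≤k = ≤-trans (≤-reflexive (+-comm ∣ b - y ∣ ∣ a - x ∣)) (point x≤k y≤k)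
    ends : ∀ {x} → x ≤ k → ∣ x - 0 ∣ + ∣ x - k ∣ ≡ k
    ends {x} x≤k = trans (cong (_+ ∣ x - k ∣) (∣-∣-identityʳ x)) (m≤n⇒m+∣m-n∣≡n x≤k)
    coordinate : ∀ {x y} → x ≤ k → y ≤ k → (∀ {s t} → s ≤ k → t ≤ k → ∣ x - s ∣ + ∣ y - t ∣ ≤ M + M) →
                 Central k x
    coordinate {x} {y} x≤k y≤k at = central x≤k
      (opposite-sides {∣ x - 0 ∣} {∣ y - 0 ∣} {∣ y - k ∣} {M}
                      (at z≤n z≤n) (at z≤n ≤-refl) (ends y≤k) M+M≤1+k)
      (opposite-sides {∣ x - k ∣} {∣ y - 0 ∣} {∣ y - k ∣} {M}
                      (at ≤-refl z≤n) (at ≤-refl ≤-refl) (ends y≤k) M+M≤1+k)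

Slot : Set
Slot = Bool × ℕ

slot : Slot → ℕ
slot (false , p) = p * 2
slot (true  , p) = suc (p * 2)

odd≢even : ∀ p q → suc (p * 2) ≢ q * 2
odd≢even p q e = 0≢1+n (trans (sym (m*n%n≡0 q 2)) (trans (cong (_% 2) (sym e)) ([m+kn]%n≡m%n 1 p 2)))

slot-injective : ∀ g g' → slot g ≡ slot g' → g ≡ g'
slot-injective (false , p) (false , q) e = cong (false ,_) (*-cancelʳ-≡ p q 2 e)
slot-injective (true  , p) (true  , q) e = cong (true ,_) (*-cancelʳ-≡ p q 2 (suc-injective e))
slot-injective (false , p) (true  , q) e = contradiction (sym e) (odd≢even q p)
slot-injective (true  , p) (false , q) e = contradiction e (odd≢even p q)

slot< : ∀ {n} β {p} → p < n → slot (β , p) < n * 2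
slot< β {p} p<n = ≤-trans (s≤s (slot≤ β)) (*-monoˡ-≤ 2 p<n)
  where
  slot≤ : ∀ β → slot (β , p) ≤ suc (p * 2)
  slot≤ false = n≤1+n _
  slot≤ true  = ≤-refl

module Sphere (k a b s : ℕ) where

  r : ℕ
  r = suc s

  OnSphere : Vertex (suc k) → Set
  OnSphere (i , j) = ∣ a - toℕ i ∣ + ∣ b - toℕ j ∣ ≡ r

  slot-of : Vertex (suc k) → Slot
  slot-of (i , j) = (b <ᵇ toℕ j) , toℕ i

  code : Vertex (suc k) → ℕ
  code v = slot (slot-of v)

  row-offset : ∀ {i j p t} → OnSphere (i , j) → toℕ i ≡ p → ∣ a - p ∣ + t ≡ r → ∣ b - toℕ j ∣ ≡ t
  row-offset {i} on refl e = +-cancelˡ-≡ ∣ a - toℕ i ∣ _ _ (trans on (sym e))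

  code-injective : ∀ {u v} → OnSphere u → OnSphere v → code u ≡ code v → u ≡ v
  code-injective {i , j} {i' , j'} on on' e
    with b <ᵇ toℕ j | <ᵇ-reflects-< b (toℕ j) | b <ᵇ toℕ j' | <ᵇ-reflects-< b (toℕ j')
       | ,-injective (slot-injective (slot-of (i , j)) (slot-of (i' , j')) e)
  ... | true  | ofʸ b<j  | true  | ofʸ b<j'  | _ , i≡i' = cong₂ _,_ (toℕ-injective i≡i') (toℕ-injective (begin
    toℕ j                 ≡⟨ m≤n⇒m+∣m-n∣≡n (<⇒≤ b<j) ⟨
    b + ∣ b - toℕ j ∣     ≡⟨ cong (b +_) (row-offset on i≡i' on') ⟩
    b + ∣ b - toℕ j' ∣    ≡⟨ m≤n⇒m+∣m-n∣≡n (<⇒≤ b<j') ⟩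
    toℕ j'                ∎))
    where open ≡-Reasoning
  ... | false | ofⁿ b≮j | false | ofⁿ b≮j' | _ , i≡i' = cong₂ _,_ (toℕ-injective i≡i') (toℕ-injective
    (+-cancelʳ-≡ ∣ b - toℕ j ∣ _ _ (begin
    toℕ j  + ∣ b - toℕ j ∣    ≡⟨ m≤n⇒m+∣n-m∣≡n (≮⇒≥ b≮j) ⟩
    b                        ≡⟨ m≤n⇒m+∣n-m∣≡n (≮⇒≥ b≮j') ⟨
    toℕ j' + ∣ b - toℕ j' ∣   ≡⟨ cong (toℕ j' +_) (row-offset on i≡i' on') ⟨
    toℕ j' + ∣ b - toℕ j ∣    ∎)))
    where open ≡-Reasoning
  ... | true  | _ | false | _ | () , _
  ... | false | _ | true  | _ | () , _

  upper-occupied : ∀ {v p t} → OnSphere v → ∣ a - p ∣ + t ≡ r → code v ≡ slot (true , p) → t ≢ 0 × b + t ≤ k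
  upper-occupied {i , j} {p} on e code≡
    with b <ᵇ toℕ j | <ᵇ-reflects-< b (toℕ j) | ,-injective (slot-injective (slot-of (i , j)) (true , p) code≡)
  ... | false | _ | () , _
  ... | true | ofʸ b<j | _ , i≡p with refl ← row-offset on i≡p e =
    <⇒≢ b<j ∘ ∣m-n∣≡0⇒m≡n , ≤-trans (≤-reflexive (m≤n⇒m+∣m-n∣≡n (<⇒≤ b<j))) (≤-pred (toℕ<n j))

  lower-occupied : ∀ {v p t} → OnSphere v → ∣ a - p ∣ + t ≡ r → code v ≡ slot (false , p) → t ≤ b
  lower-occupied {i , j} {p} on e code≡
    with b <ᵇ toℕ j | <ᵇ-reflects-< b (toℕ j) | ,-injective (slot-injective (slot-of (i , j)) (false , p) code≡)
  ... | true | _ | () , _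
  ... | false | ofⁿ b≮j | _ , i≡p with refl ← row-offset on i≡p e =
    ≤-trans (m≤n+m _ (toℕ j)) (≤-reflexive (m≤n⇒m+∣n-m∣≡n (≮⇒≥ b≮j)))

  Gap : Slot → Set
  Gap (β , p) = p ≤ k × ∀ v → OnSphere v → code v ≢ slot (β , p)

  upper-gap : ∀ {p t} → p ≤ k → ∣ a - p ∣ + t ≡ r → t ≡ 0 ⊎ k < b + t → Gap (true , p)
  upper-gap p≤k e (inj₁ t≡0)    = p≤k , λ _ on code≡ → proj₁ (upper-occupied on e code≡) t≡0
  upper-gap p≤k e (inj₂ k<b+t) = p≤k , λ _ on code≡ → <⇒≱ k<b+t (proj₂ (upper-occupied on e code≡))

  lower-gap : ∀ {p t} → p ≤ k → ∣ a - p ∣ + t ≡ r → b < t → Gap (false , p)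
  lower-gap p≤k e b<t = p≤k , λ _ on code≡ → <⇒≱ b<t (lower-occupied on e code≡)

  far-gap : ∀ {p} → p ≤ k → ∣ a - p ∣ ≡ r → Gap (true , p)
  far-gap p≤k e = upper-gap p≤k (trans (+-identityʳ _) e) (inj₁ refl)

  thin-gap : ∀ {p t} → p ≤ k → ∣ a - p ∣ + t ≡ r → k < t + t → Σ Bool λ β → Gap (β , p)
  thin-gap {p} {t} p≤k e k<t+t with k <? b + t
  ... | yes k<b+t = true  , upper-gap p≤k e (inj₂ k<b+t)
  ... | no  k≮b+t = false , lower-gap p≤k e (+-cancelʳ-< t b t (≤-<-trans (≮⇒≥ k≮b+t) k<t+t))

  center-column : ∣ a - a ∣ + r ≡ r
  center-column = cong (_+ r) (∣n-n∣≡0 a)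

  distinct-columns : ∀ {β β' : Bool} {p o} → ∣ a - p ∣ ≡ suc o → (β , a) ≢ (β' , p)
  distinct-columns e = ∣m-n∣≡1+o⇒m≢n e ∘ ,-injectiveʳ

  TwoGaps : Set
  TwoGaps = ∃₂ λ (g g' : Slot) → g ≢ g' × Gap g × Gap g'

  small-radius-gaps : a ≤ k → Central k a → r + r ≤ k → TwoGaps
  small-radius-gaps a≤k (a+a≤1+k , k≤1+a+a) r+r≤k =
    (true , a ∸ r) , (true , a + r) , <⇒≢ (≤-<-trans (m∸n≤m a r) (m<m+n a z<s)) ∘ ,-injectiveʳ ,
    far-gap (≤-trans (m∸n≤m a r) a≤k) (∣m-[m∸n]∣≡n r≤a) , far-gap a+r≤k (∣m-m+n∣≡n a r)
    where
    open ≤-Reasoning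
    r≤a : r ≤ a
    r≤a = halve-≤ (≤-trans r+r≤k k≤1+a+a)
    a+r≤k : a + r ≤ k
    a+r≤k = halve-≤ (begin
      (a + r) + (a + r)  ≡⟨ interchange a r a r ⟩
      (a + a) + (r + r)  ≤⟨ +-mono-≤ a+a≤1+k r+r≤k ⟩
      suc k + k          ∎)

  wrapping-gaps : a ≤ k → Central k b → 0 < k → k < a + r → a < r → Σ Bool (λ β → Gap (β , a)) → TwoGaps
  wrapping-gaps a≤k (b+b≤1+k , k≤1+b+b) 0<k k<a+r a<r (β , gap) with neighbour 0<k a≤k | k <? s + s
  ... | q , q≤k , ∣a-q∣≡1 | yes k<s+s =
    let β' , gap' = thin-gap q≤k (cong (_+ s) ∣a-q∣≡1) k<s+s in
    (β , a) , (β' , q) , distinct-columns ∣a-q∣≡1 , gap , gap'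
  ... | _ | no k≮s+s =
    (false , a) , (true , a) , (λ ()) ,
    lower-gap a≤k center-column b<r , upper-gap a≤k center-column (inj₂ k<b+r)
    where
    open ≤-Reasoning
    -- k = s + s here, which forces b = s
    k≤s+s : k ≤ s + s
    k≤s+s = ≤-trans (≤-pred (≤-trans k<a+r (≤-reflexive (+-suc a s)))) (+-monoˡ-≤ s (≤-pred a<r))
    b<r : b < r
    b<r = s≤s (halve-≤ (≤-trans b+b≤1+k (s≤s k≤s+s)))
    k<b+r : k < b + r
    k<b+r = begin-strict
      k       ≤⟨ k≤s+s ⟩
      s + s   ≤⟨ +-monoˡ-≤ s (halve-≤ (≤-trans (≮⇒≥ k≮s+s) k≤1+b+b)) ⟩
      b + s   <⟨ +-monoʳ-< b (n<1+n s) ⟩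
      b + r   ∎

  large-radius-gaps : a ≤ k → Central k b → 0 < k → k < r + r → TwoGaps
  large-radius-gaps a≤k cb 0<k k<r+r with thin-gap a≤k center-column k<r+r | a + r ≤? k | r ≤? a
  ... | β , gap | yes a+r≤k | _ =
    (β , a) , (true , a + r) , distinct-columns (∣m-m+n∣≡n a r) , gap , far-gap a+r≤k (∣m-m+n∣≡n a r)
  ... | β , gap | no _ | yes r≤a =
    (β , a) , (true , a ∸ r) , distinct-columns (∣m-[m∸n]∣≡n r≤a) , gap ,
    far-gap (≤-trans (m∸n≤m a r) a≤k) (∣m-[m∸n]∣≡n r≤a)
  ... | thin | no a+r≰k | no r≰a = wrapping-gaps a≤k cb 0<k (≰⇒> a+r≰k) (≰⇒> r≰a) thin

  two-gaps : a ≤ k → Central k a → Central k b → 0 < k → TwoGaps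
  two-gaps a≤k ca cb 0<k with r + r ≤? k
  ... | yes r+r≤k = small-radius-gaps a≤k ca r+r≤k
  ... | no  r+r≰k = large-radius-gaps a≤k cb 0<k (≰⇒> r+r≰k)

  sphere-bound : TwoGaps → ∀ {vs} → Unique vs → All OnSphere vs → length vs + 2 ≤ suc k * 2
  sphere-bound (g@(β , p) , g'@(β' , p') , g≢g' , (p≤k , gap) , (p'≤k , gap')) {vs} !vs on-vs = begin
    length vs + 2                              ≡⟨ +-comm (length vs) 2 ⟩
    2 + length vs                              ≡⟨ cong (2 +_) (length-map code vs) ⟨
    length (slot g ∷ slot g' ∷ map code vs)    ≤⟨ unique-bounded-length (suc k * 2) !codes codes< ⟩
    suc k * 2                                  ∎
    where
    open ≤-Reasoning
    misses : ∀ h → (∀ v → OnSphere v → code v ≢ slot h) → All (slot h ≢_) (map code vs)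
    misses h gap = map⁺ (All.map (λ {v} on → gap v on ∘ sym) on-vs)
    !codes : Unique (slot g ∷ slot g' ∷ map code vs)
    !codes = (g≢g' ∘ slot-injective g g' ∷ misses g gap) ∷ misses g' gap' ∷
             map⁺-on code code-injective on-vs !vs
    codes< : All (_< suc k * 2) (slot g ∷ slot g' ∷ map code vs)
    codes< = slot< β (s≤s p≤k) ∷ slot< β' (s≤s p'≤k) ∷
             map⁺ (All.universal (λ (i , j) → slot< (b <ᵇ toℕ j) (toℕ<n i)) vs)

lemma1 : ∀ (n : ℕ) → 1 < n → (c : Vertex n) → Center c →
         (V' : List (Vertex n)) → Unique V' →
         (r : ℕ) → All (λ v → Dist c v r) V' →
         length V' ≤ 2 * n ∸ 2
lemma1 (suc zero) (s≤s ())
lemma1 (suc (suc k)) 1<n _ _ V' !V' zero at-center =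
  ≤-trans (length≤1-of-constant !V' (All.map Dist-zero⇒≡ at-center))
          (m+n≤o⇒m≤o∸n 1 (≤-trans (n≤1+n 3) (*-monoʳ-≤ 2 1<n)))
lemma1 (suc (suc k)) _ (i , j) center V' !V' (suc s) at-distance =
  m+n≤o⇒m≤o∸n (length V') (subst (length V' + 2 ≤_) (*-comm (suc (suc k)) 2)
    (sphere-bound (two-gaps (≤-pred (toℕ<n i)) (proj₁ coordinates) (proj₂ coordinates) z<s) !V' on-sphere))
  where
  open Sphere (suc k) (toℕ i) (toℕ j) s
  coordinates : Central (suc k) (toℕ i) × Central (suc k) (toℕ j)
  coordinates = Midpoint.center⇒central (suc k) center
  on-sphere : All OnSphere V'
  on-sphere = All.map (λ { {_ , _} d → sym (Dist⇒≡manhattan d) }) at-distance
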